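{- Let $n\ge3$ and let $H=([n],E)$ be the complete $3$-uniform hypergraph, i.e. $E$ is the set of all $\binom{n}{3}$ three-element subsets of $[n]$. For integers $3\le l_1\le 2n-3$ and $5\le l_2\le 2n-1$ let $E_{l_1,l_2}=\{\{a,b,c\}\in E: a<b<c,\ a+b=l_1,\ b+c=l_2\}$. Then every $E_{l_1,l_2}$ is a matching (its edges are pairwise disjoint) and $E=\bigcup_{l_1,l_2}E_{l_1,l_2}$. Moreover, the set $E_n=\{(l_1,l_2): \exists\,1\le a<b<c\le n \text{ with } l_1=a+b,\ l_2=b+c\}$ has cardinality $\frac32n^2-\frac{15}{2}n+10$. -}

module Defs where

open import Data.Nat using (ℕ; _+_; _≤_; _<_)
open import Data.Product using (_×_; _,_; ∃-syntax)
open import Data.Sum using (_⊎_)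
open import Data.Empty using (⊥)
open import Relation.Binary.PropositionalEquality using (_≡_)

-- A 3-element subset {a,b,c} of [n] = {1,…,n} is represented canonically
-- by its increasing listing (a , b , c) with 1 ≤ a < b < c ≤ n.
Triple : Set
Triple = ℕ × ℕ × ℕ

InE : ℕ → Triple → Set
InE n (a , b , c) = 1 ≤ a × a < b × b < c × c ≤ n

InElℓ : ℕ → ℕ → ℕ → Triple → Set
InElℓ n l₁ l₂ (a , b , c) = InE n (a , b , c) × a + b ≡ l₁ × b + c ≡ l₂

_∈ᵉ_ : ℕ → Triple → Set
x ∈ᵉ (a , b , c) = x ≡ a ⊎ x ≡ b ⊎ x ≡ c

Disjoint : Triple → Triple → Set
Disjoint e f = ∀ x → x ∈ᵉ e → x ∈ᵉ f → ⊥

IsMatching : (Triple → Set) → Set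
IsMatching S = ∀ e f → S e → S f → e ≡ f ⊎ Disjoint e f

InEn : ℕ → ℕ × ℕ → Set
InEn n (l₁ , l₂) =
  ∃[ a ] ∃[ b ] ∃[ c ] (InE n (a , b , c) × l₁ ≡ a + b × l₂ ≡ b + c)

-- The move (a , b , c) ↦ (a + 1 , b − 1 , c + 1) preserves both sums a + b and
-- b + c, and two triples with the same sums differ by such moves: if a < a′ then
-- a < a′ < b′ < b < c < c′. Hence the edges of one class E_{l₁,l₂} interleave and
-- are pairwise disjoint. To count the classes, pick in each the representative with
-- the largest a, i.e. the one that cannot be moved any further: either b ≤ a + 2 or
-- c = n. These representatives fall into three families (b = a + 1, b = a + 2, and
-- c = n with b ≥ a + 3) of sizes (n−1 choose 2), (n−2 choose 2) and (n−3 choose 2),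
-- which add up to (3n² − 15n + 20)/2.
module Submission where

open import Defs
open import Data.Nat using (ℕ; zero; suc; _+_; _*_; _∸_; _^_; _≤_; _<_; _≟_; _≤?_; z≤n; s≤s)
open import Data.Nat.Properties
open import Data.Nat.Tactic.RingSolver using (solve-∀)
open import Data.Product using (_×_; _,_; ∃-syntax; proj₁; uncurry)
open import Data.Product.Properties using (,-injectiveˡ; ,-injectiveʳ)
open import Data.Sum using (_⊎_; inj₁; inj₂)
open import Data.Empty using (⊥; ⊥-elim)
open import Data.List using (List; []; _∷_; _++_; map; applyUpTo; length)
open import Data.List.Properties using (length-map; length-++; length-applyUpTo)
open import Data.List.Relation.Unary.Any using (here; there)
open import Data.List.Membership.Propositional using (_∈_)
open import Data.List.Membership.Propositional.Properties
  using (∈-map⁺; ∈-map⁻; ∈-++⁺ˡ; ∈-++⁺ʳ; ∈-++⁻; ∈-applyUpTo⁺; ∈-applyUpTo⁻)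
import Data.List.Relation.Unary.All as All
import Data.List.Relation.Unary.All.Properties as All
open import Data.List.Relation.Unary.AllPairs using (_∷_; [])
open import Data.List.Relation.Unary.Unique.Propositional using (Unique)
import Data.List.Relation.Unary.Unique.Propositional.Properties as Unique
open import Function.Base using (_∘_)
open import Function.Bundles using (_⇔_; mk⇔)
open import Relation.Nullary using (yes; no; ¬_)
open import Relation.Binary.PropositionalEquality
  using (_≡_; _≢_; refl; sym; trans; cong; cong₂; subst; module ≡-Reasoning)
open import Relation.Binary.Definitions using (tri<; tri≈; tri>)

<∧≢1+∧≢2+⇒3+≤ : ∀ {a b} → a < b → b ≢ 1 + a → b ≢ 2 + a → 3 + a ≤ b
<∧≢1+∧≢2+⇒3+≤ a<b b≢1+a b≢2+a = ≤∧≢⇒< (≤∧≢⇒< a<b (b≢1+a ∘ sym)) (b≢2+a ∘ sym)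

map-injectiveOn⁺ : ∀ {A B : Set} (f : A → B) {xs : List A} →
  (∀ {x y} → x ∈ xs → y ∈ xs → f x ≡ f y → x ≡ y) → Unique xs → Unique (map f xs)
map-injectiveOn⁺ f {[]}     _   []            = []
map-injectiveOn⁺ f {x ∷ xs} inj (x∉xs ∷ xs!) =
  All.map⁺ (All.tabulate λ y∈ fx≡fy → All.lookup x∉xs y∈ (inj (here refl) (there y∈) fx≡fy))
  ∷ map-injectiveOn⁺ f (λ x∈ y∈ → inj (there x∈) (there y∈)) xs!

sums : Triple → ℕ × ℕ
sums (a , b , c) = a + b , b + c

sums-interleave : ∀ {a b c a′ b′ c′} → a < a′ →
  sums (a , b , c) ≡ sums (a′ , b′ , c′) → b′ < b × c < c′
sums-interleave {a} {b} {c} {a′} {b′} {c′} a<a′ eq = b′<b , c<c′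
  where
  b′<b : b′ < b
  b′<b = ≰⇒> λ b≤b′ → <-irrefl (,-injectiveˡ eq) (+-mono-<-≤ a<a′ b≤b′)
  c<c′ : c < c′
  c<c′ = ≰⇒> λ c′≤c → <-irrefl (sym (,-injectiveʳ eq)) (+-mono-<-≤ b′<b c′≤c)

sums-trichotomy : ∀ {a b c a′ b′ c′} → sums (a , b , c) ≡ sums (a′ , b′ , c′) →
  (a , b , c) ≡ (a′ , b′ , c′)
  ⊎ (a < a′ × b′ < b × c < c′)
  ⊎ (a′ < a × b < b′ × c′ < c)
sums-trichotomy {a} {b} {c} {a′} {b′} {c′} eq with <-cmp a a′
... | tri< a<a′ _ _ = inj₂ (inj₁ (a<a′ , sums-interleave a<a′ eq))
... | tri> _ _ a′<a = inj₂ (inj₂ (a′<a , sums-interleave a′<a (sym eq)))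
... | tri≈ _ refl _
  with refl ← +-cancelˡ-≡ a b b′ (,-injectiveˡ eq)
  with refl ← +-cancelˡ-≡ b c c′ (,-injectiveʳ eq) = inj₁ refl

interleaved-disjoint : ∀ {a b c a′ b′ c′} →
  a < a′ → a′ < b′ → b′ < b → b < c → c < c′ → Disjoint (a , b , c) (a′ , b′ , c′)
interleaved-disjoint p q r s t x (inj₁ refl)        (inj₁ refl)        = n≮n _ p
interleaved-disjoint p q r s t x (inj₁ refl)        (inj₂ (inj₁ refl)) = n≮n _ (<-trans p q)
interleaved-disjoint p q r s t x (inj₁ refl)        (inj₂ (inj₂ refl)) = n≮n _ (<-trans p (<-trans q (<-trans r (<-trans s t))))
interleaved-disjoint p q r s t x (inj₂ (inj₁ refl)) (inj₁ refl)        = n≮n _ (<-trans q r)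
interleaved-disjoint p q r s t x (inj₂ (inj₁ refl)) (inj₂ (inj₁ refl)) = n≮n _ r
interleaved-disjoint p q r s t x (inj₂ (inj₁ refl)) (inj₂ (inj₂ refl)) = n≮n _ (<-trans s t)
interleaved-disjoint p q r s t x (inj₂ (inj₂ refl)) (inj₁ refl)        = n≮n _ (<-trans q (<-trans r s))
interleaved-disjoint p q r s t x (inj₂ (inj₂ refl)) (inj₂ (inj₁ refl)) = n≮n _ (<-trans r s)
interleaved-disjoint p q r s t x (inj₂ (inj₂ refl)) (inj₂ (inj₂ refl)) = n≮n _ t

sums-equal⇒≡⊎disjoint : ∀ {n e f} → InE n e → InE n f → sums e ≡ sums f →
  e ≡ f ⊎ Disjoint e f
sums-equal⇒≡⊎disjoint (_ , a<b , b<c , _) (_ , a′<b′ , b′<c′ , _) eq with sums-trichotomy eq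
... | inj₁ e≡f = inj₁ e≡f
... | inj₂ (inj₁ (a<a′ , b′<b , c<c′)) = inj₂ (interleaved-disjoint a<a′ a′<b′ b′<b b<c c<c′)
... | inj₂ (inj₂ (a′<a , b<b′ , c′<c)) =
  inj₂ λ x x∈e x∈f → interleaved-disjoint a′<a a<b b<b′ b′<c′ c′<c x x∈f x∈e

Elℓ-isMatching : ∀ n l₁ l₂ → IsMatching (InElℓ n l₁ l₂)
Elℓ-isMatching n l₁ l₂ (a , b , c) (a′ , b′ , c′) (ie , refl , refl) (ie′ , eq₁ , eq₂) =
  sums-equal⇒≡⊎disjoint ie ie′ (sym (cong₂ _,_ eq₁ eq₂))

sum-≤-2*∸ : ∀ {x y n} i j → i + x ≤ n → j + y ≤ n → x + y ≤ 2 * n ∸ (i + j)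
sum-≤-2*∸ {x} {y} {n} i j i+x≤n j+y≤n = m+n≤o⇒m≤o∸n (x + y) (begin
  x + y + (i + j)  ≡⟨ regroup x y i j ⟩
  (i + x) + (j + y) ≤⟨ +-mono-≤ i+x≤n j+y≤n ⟩
  n + n             ≡⟨ cong (n +_) (sym (+-identityʳ n)) ⟩
  2 * n             ∎)
  where
  open ≤-Reasoning
  regroup : ∀ x y i j → x + y + (i + j) ≡ (i + x) + (j + y)
  regroup = solve-∀

InE⇒InElℓ-sums : ∀ {n} e → InE n e →
  ∃[ l₁ ] ∃[ l₂ ] (3 ≤ l₁ × l₁ ≤ 2 * n ∸ 3 × 5 ≤ l₂ × l₂ ≤ 2 * n ∸ 1 × InElℓ n l₁ l₂ e)
InE⇒InElℓ-sums {n} (a , b , c) ie@(1≤a , a<b , b<c , c≤n) =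
  a + b , b + c ,
  +-mono-≤ 1≤a 2≤b , sum-≤-2*∸ 2 1 (≤-trans (s≤s a<b) 1+b≤n) 1+b≤n ,
  +-mono-≤ 2≤b (≤-trans (s≤s 2≤b) b<c) , sum-≤-2*∸ 1 0 1+b≤n c≤n ,
  ie , refl , refl
  where
  2≤b : 2 ≤ b
  2≤b = ≤-trans (s≤s 1≤a) a<b
  1+b≤n : 1 + b ≤ n
  1+b≤n = ≤-trans b<c c≤n

Canonical : ℕ → Triple → Set
Canonical n (a , b , c) = b ≤ 2 + a ⊎ c ≡ n

canonical-exists : ∀ {n} k {a b c} → c + k ≡ n → InE n (a , b , c) →
  ∃[ t ] (InE n t × Canonical n t × sums t ≡ sums (a , b , c))
canonical-exists k {a} {b} c+k≡n ie with b ≤? 2 + a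
... | yes b≤2+a = _ , ie , inj₁ b≤2+a , refl
canonical-exists zero {c = c} c+0≡n ie | no _ =
  _ , ie , inj₂ (trans (sym (+-identityʳ c)) c+0≡n) , refl
canonical-exists {n} (suc k) {a} {suc b} {c} c+1+k≡n (_ , _ , b<c , _) | no b≰2+a
  = let t , ie , can , eq = canonical-exists k 1+c+k≡n moved
    in t , ie , can , trans eq (cong₂ _,_ (sym (+-suc a b)) (+-suc b c))
  where
  1+c+k≡n : suc c + k ≡ n
  1+c+k≡n = trans (sym (+-suc c k)) c+1+k≡n
  moved : InE n (suc a , b , suc c)
  moved = s≤s z≤n , ≤-pred (≰⇒> b≰2+a) , ≤-trans (n≤1+n _) (≤-trans b<c (n≤1+n c)) ,
          ≤-trans (m≤m+n (suc c) k) (≤-reflexive 1+c+k≡n)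

canonical-not-below : ∀ {n a b c a′ b′ c′} → Canonical n (a , b , c) → InE n (a′ , b′ , c′) →
  a < a′ → b′ < b → c < c′ → ⊥
canonical-not-below (inj₁ b≤2+a) (_ , a′<b′ , _) a<a′ b′<b _ =
  n≮n _ (≤-trans (s≤s (s≤s a<a′)) (≤-trans (s≤s a′<b′) (≤-trans b′<b b≤2+a)))
canonical-not-below (inj₂ refl) (_ , _ , _ , c′≤n) _ _ c<c′ = n≮n _ (≤-trans c<c′ c′≤n)

canonical-unique : ∀ {n s t} → InE n s → InE n t → Canonical n s → Canonical n t →
  sums s ≡ sums t → s ≡ t
canonical-unique ie ie′ can can′ eq with sums-trichotomy eq
... | inj₁ s≡t = s≡t
... | inj₂ (inj₁ (a<a′ , b′<b , c<c′)) = ⊥-elim (canonical-not-below can ie′ a<a′ b′<b c<c′)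
... | inj₂ (inj₂ (a′<a , b<b′ , c′<c)) = ⊥-elim (canonical-not-below can′ ie a′<a b<b′ c′<c)

GapPair : ℕ → ℕ → ℕ × ℕ → Set
GapPair k t (x , y) = 1 ≤ x × k + x ≤ y × y < k + t

gapPairs : ℕ → ℕ → List (ℕ × ℕ)
gapPairs k zero    = []
gapPairs k (suc t) = map (_, k + t) (applyUpTo suc t) ++ gapPairs k t

∈-gapPairs⁻ : ∀ k t {p} → p ∈ gapPairs k t → GapPair k t p
∈-gapPairs⁻ k (suc t) p∈ with ∈-++⁻ (map (_, k + t) (applyUpTo suc t)) p∈
... | inj₁ p∈new
  with _ , x∈ , refl ← ∈-map⁻ (_, k + t) p∈new
  with i , i<t , refl ← ∈-applyUpTo⁻ suc x∈ =
  s≤s z≤n , +-monoʳ-≤ k i<t , +-monoʳ-< k (n<1+n t)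
... | inj₂ p∈old =
  let 1≤x , k+x≤y , y<k+t = ∈-gapPairs⁻ k t p∈old
  in 1≤x , k+x≤y , <-trans y<k+t (+-monoʳ-< k (n<1+n t))

∈-gapPairs⁺ : ∀ k t {p} → GapPair k t p → p ∈ gapPairs k t
∈-gapPairs⁺ k zero {x , y} (_ , k+x≤y , y<k+0) =
  ⊥-elim (<⇒≱ (subst (y <_) (+-identityʳ k) y<k+0) (≤-trans (m≤m+n k x) k+x≤y))
∈-gapPairs⁺ k (suc t) {x , y} (1≤x@(s≤s {n = i} z≤n) , k+x≤y , y<k+1+t) with y ≟ k + t
... | yes refl = ∈-++⁺ˡ (∈-map⁺ (_, k + t) (∈-applyUpTo⁺ suc (+-cancelˡ-≤ k (suc i) t k+x≤y)))
... | no y≢k+t = ∈-++⁺ʳ (map (_, k + t) (applyUpTo suc t))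
  (∈-gapPairs⁺ k t (1≤x , k+x≤y , ≤∧≢⇒< (≤-pred (≤-trans y<k+1+t (≤-reflexive (+-suc k t)))) y≢k+t))

gapPairs⁺ : ∀ k t → Unique (gapPairs k t)
gapPairs⁺ k zero    = []
gapPairs⁺ k (suc t) =
  Unique.++⁺ (Unique.map⁺ ,-injectiveˡ (Unique.applyUpTo⁺₁ suc t λ i<j _ → <⇒≢ (s≤s i<j)))
             (gapPairs⁺ k t) new∉old
  where
  new∉old : ∀ {p} → ¬ (p ∈ map (_, k + t) (applyUpTo suc t) × p ∈ gapPairs k t)
  new∉old (p∈new , p∈old) with _ , _ , refl ← ∈-map⁻ (_, k + t) p∈new =
    let _ , _ , k+t<k+t = ∈-gapPairs⁻ k t p∈old in n≮n _ k+t<k+t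

-- That is, gapPairs k t has (t choose 2) elements.
length-gapPairs : ∀ k t → 2 * length (gapPairs k t) + t ≡ t * t
length-gapPairs k zero    = refl
length-gapPairs k (suc t) = begin
  2 * length (map (_, k + t) (applyUpTo suc t) ++ gapPairs k t) + suc t
    ≡⟨ cong (λ l → 2 * l + suc t) (length-++ (map (_, k + t) (applyUpTo suc t))) ⟩
  2 * (length (map (_, k + t) (applyUpTo suc t)) + L) + suc t
    ≡⟨ cong (λ l → 2 * (l + L) + suc t)
         (trans (length-map (_, k + t) (applyUpTo suc t)) (length-applyUpTo suc t)) ⟩
  2 * (t + L) + suc t
    ≡⟨ regroup t L ⟩
  (2 * L + t) + (2 * t + 1)
    ≡⟨ cong (_+ (2 * t + 1)) (length-gapPairs k t) ⟩
  t * t + (2 * t + 1)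
    ≡⟨ square-suc t ⟩
  suc t * suc t ∎
  where
  open ≡-Reasoning
  L : ℕ
  L = length (gapPairs k t)
  regroup : ∀ t L → 2 * (t + L) + suc t ≡ (2 * L + t) + (2 * t + 1)
  regroup = solve-∀
  square-suc : ∀ t → t * t + (2 * t + 1) ≡ suc t * suc t
  square-suc = solve-∀

withGap : ℕ → ℕ × ℕ → Triple
withGap d (a , c) = a , d + a , c

withGap-injective : ∀ d {p q} → withGap d p ≡ withGap d q → p ≡ q
withGap-injective d {_ , _} {_ , _} refl = refl

endingAt : ℕ → ℕ × ℕ → Triple
endingAt n (a , b) = a , b , n

endingAt-injective : ∀ n {p q} → endingAt n p ≡ endingAt n q → p ≡ q
endingAt-injective n {_ , _} {_ , _} refl = refl

canonicalTriples : ℕ → List Triple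
canonicalTriples n =
  map (withGap 1) (gapPairs 2 (n ∸ 1)) ++
  map (withGap 2) (gapPairs 3 (n ∸ 2)) ++
  map (endingAt n) (gapPairs 3 (n ∸ 3))

module _ (m : ℕ) where

  private
    n : ℕ
    n = 3 + m

    family₁ family₂ family₃ : List Triple
    family₁ = map (withGap 1) (gapPairs 2 (2 + m))
    family₂ = map (withGap 2) (gapPairs 3 (1 + m))
    family₃ = map (endingAt n) (gapPairs 3 m)

  ∈-canonicalTriples⁻ : ∀ {t} → t ∈ canonicalTriples n → InE n t × Canonical n t
  ∈-canonicalTriples⁻ t∈ with ∈-++⁻ family₁ t∈
  ... | inj₁ t∈₁ with (a , c) , p∈ , refl ← ∈-map⁻ (withGap 1) t∈₁ =
    let 1≤a , 2+a≤c , c<n+1 = ∈-gapPairs⁻ 2 (2 + m) p∈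
    in (1≤a , ≤-refl , 2+a≤c , ≤-pred c<n+1) , inj₁ (n≤1+n _)
  ... | inj₂ t∈₂₃ with ∈-++⁻ family₂ t∈₂₃
  ... | inj₁ t∈₂ with (a , c) , p∈ , refl ← ∈-map⁻ (withGap 2) t∈₂ =
    let 1≤a , 3+a≤c , c<n+1 = ∈-gapPairs⁻ 3 (1 + m) p∈
    in (1≤a , n≤1+n _ , 3+a≤c , ≤-pred c<n+1) , inj₁ ≤-refl
  ... | inj₂ t∈₃ with (a , b) , p∈ , refl ← ∈-map⁻ (endingAt n) t∈₃ =
    let 1≤a , 3+a≤b , b<n = ∈-gapPairs⁻ 3 m p∈
    in (1≤a , ≤-trans (n≤1+n _) (≤-trans (n≤1+n _) 3+a≤b) , b<n , ≤-refl) , inj₂ refl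

  ∈-canonicalTriples⁺ : ∀ {t} → InE n t → Canonical n t → t ∈ canonicalTriples n
  ∈-canonicalTriples⁺ {a , b , c} (1≤a , a<b , b<c , c≤n) can with b ≟ 1 + a | b ≟ 2 + a
  ... | yes refl | _ =
    ∈-++⁺ˡ (∈-map⁺ (withGap 1) (∈-gapPairs⁺ 2 (2 + m) (1≤a , b<c , s≤s c≤n)))
  ... | no _ | yes refl =
    ∈-++⁺ʳ family₁ (∈-++⁺ˡ (∈-map⁺ (withGap 2) (∈-gapPairs⁺ 3 (1 + m) (1≤a , b<c , s≤s c≤n))))
  ... | no b≢1+a | no b≢2+a with can
  ...   | inj₁ b≤2+a = ⊥-elim (<⇒≱ (<∧≢1+∧≢2+⇒3+≤ a<b b≢1+a b≢2+a) b≤2+a)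
  ...   | inj₂ refl =
    ∈-++⁺ʳ family₁ (∈-++⁺ʳ family₂
      (∈-map⁺ (endingAt n) (∈-gapPairs⁺ 3 m (1≤a , <∧≢1+∧≢2+⇒3+≤ a<b b≢1+a b≢2+a , b<c))))

  private
    family₂∩family₃=∅ : ∀ {t} → t ∈ family₂ → t ∈ family₃ → ⊥
    family₂∩family₃=∅ t∈₂ t∈₃ with ∈-map⁻ (withGap 2) t∈₂ | ∈-map⁻ (endingAt n) t∈₃
    ... | _ , _ , refl | _ , p∈ , refl =
      let _ , 3+a≤2+a , _ = ∈-gapPairs⁻ 3 m p∈ in n≮n _ 3+a≤2+a

    family₁∩family₂₃=∅ : ∀ {t} → t ∈ family₁ → t ∈ family₂ ++ family₃ → ⊥
    family₁∩family₂₃=∅ t∈₁ t∈₂₃ with ∈-map⁻ (withGap 1) t∈₁ | ∈-++⁻ family₂ t∈₂₃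
    ... | _ , _ , refl | inj₁ t∈₂ with ∈-map⁻ (withGap 2) t∈₂
    ...   | _ , _ , ()
    family₁∩family₂₃=∅ t∈₁ t∈₂₃ | _ , _ , refl | inj₂ t∈₃ with ∈-map⁻ (endingAt n) t∈₃
    ...   | _ , p∈ , refl = let _ , 3+a≤1+a , _ = ∈-gapPairs⁻ 3 m p∈ in <⇒≱ 3+a≤1+a (n≤1+n _)

  canonicalTriples⁺ : Unique (canonicalTriples n)
  canonicalTriples⁺ =
    Unique.++⁺ (Unique.map⁺ (withGap-injective 1) (gapPairs⁺ 2 (2 + m)))
      (Unique.++⁺ (Unique.map⁺ (withGap-injective 2) (gapPairs⁺ 3 (1 + m)))
                  (Unique.map⁺ (endingAt-injective n) (gapPairs⁺ 3 m))
                  (uncurry family₂∩family₃=∅))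
      (uncurry family₁∩family₂₃=∅)

  length-canonicalTriples : 2 * length (canonicalTriples n) + 15 * n ≡ 3 * n ^ 2 + 20
  length-canonicalTriples = begin
    2 * length (family₁ ++ family₂ ++ family₃) + 15 * n
      ≡⟨ cong (λ l → 2 * l + 15 * n) (trans (length-++ family₁)
           (cong₂ _+_ (length-map (withGap 1) (gapPairs 2 (2 + m)))
             (trans (length-++ family₂)
               (cong₂ _+_ (length-map (withGap 2) (gapPairs 3 (1 + m)))
                          (length-map (endingAt n) (gapPairs 3 m)))))) ⟩
    2 * (l₁ + (l₂ + l₃)) + 15 * n
      ≡⟨ +-cancelʳ-≡ (3 * m + 3) _ _ (begin
         2 * (l₁ + (l₂ + l₃)) + 15 * n + (3 * m + 3)
           ≡⟨ regroup m l₁ l₂ l₃ ⟩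
         (2 * l₁ + (2 + m)) + (2 * l₂ + (1 + m)) + (2 * l₃ + m) + 15 * n
           ≡⟨ cong (_+ 15 * n) (cong₂ _+_ (cong₂ _+_ (length-gapPairs 2 (2 + m))
                                                   (length-gapPairs 3 (1 + m)))
                                        (length-gapPairs 3 m)) ⟩
         (2 + m) * (2 + m) + (1 + m) * (1 + m) + m * m + 15 * n
           ≡⟨ squares m ⟩
         3 * (n * (n * 1)) + 20 + (3 * m + 3) ∎) ⟩
    3 * n ^ 2 + 20 ∎
    where
    open ≡-Reasoning
    l₁ l₂ l₃ : ℕ
    l₁ = length (gapPairs 2 (2 + m))
    l₂ = length (gapPairs 3 (1 + m))
    l₃ = length (gapPairs 3 m)
    regroup : ∀ m x y z → 2 * (x + (y + z)) + 15 * (3 + m) + (3 * m + 3)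
                        ≡ (2 * x + (2 + m)) + (2 * y + (1 + m)) + (2 * z + m) + 15 * (3 + m)
    regroup = solve-∀
    -- n ^ 2 is unfolded: the ring solver does not handle _^_.
    squares : ∀ m → (2 + m) * (2 + m) + (1 + m) * (1 + m) + m * m + 15 * (3 + m)
                  ≡ 3 * ((3 + m) * ((3 + m) * 1)) + 20 + (3 * m + 3)
    squares = solve-∀

  sums-canonicalTriples⁺ : Unique (map sums (canonicalTriples n))
  sums-canonicalTriples⁺ = map-injectiveOn⁺ sums injectiveOn canonicalTriples⁺
    where
    injectiveOn : ∀ {s t} → s ∈ canonicalTriples n → t ∈ canonicalTriples n →
                  sums s ≡ sums t → s ≡ t
    injectiveOn s∈ t∈ =
      let ie , can = ∈-canonicalTriples⁻ s∈
          ie′ , can′ = ∈-canonicalTriples⁻ t∈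
      in canonical-unique ie ie′ can can′

  ∈-sums-canonicalTriples⇔InEn : ∀ p → p ∈ map sums (canonicalTriples n) ⇔ InEn n p
  ∈-sums-canonicalTriples⇔InEn _ = mk⇔ to from
    where
    to : ∀ {p} → p ∈ map sums (canonicalTriples n) → InEn n p
    to p∈ with (a , b , c) , t∈ , refl ← ∈-map⁻ sums {xs = canonicalTriples n} p∈ =
      a , b , c , proj₁ (∈-canonicalTriples⁻ t∈) , refl , refl
    from : ∀ {p} → InEn n p → p ∈ map sums (canonicalTriples n)
    from (a , b , c , ie@(_ , _ , _ , c≤n) , refl , refl) =
      let t , ie′ , can , eq = canonical-exists (n ∸ c) (m+[n∸m]≡n c≤n) ie
      in subst (_∈ map sums (canonicalTriples n)) eq (∈-map⁺ sums (∈-canonicalTriples⁺ ie′ can))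

proposition3p4 : (n : ℕ) → 3 ≤ n →
    ((l₁ l₂ : ℕ) → 3 ≤ l₁ → l₁ ≤ 2 * n ∸ 3 → 5 ≤ l₂ → l₂ ≤ 2 * n ∸ 1 →
        IsMatching (InElℓ n l₁ l₂))
    × (∀ e → InE n e →
        ∃[ l₁ ] ∃[ l₂ ] (3 ≤ l₁ × l₁ ≤ 2 * n ∸ 3 × 5 ≤ l₂ × l₂ ≤ 2 * n ∸ 1 × InElℓ n l₁ l₂ e))
    × (∃[ xs ] (Unique xs × (∀ p → (p ∈ xs) ⇔ InEn n p)
        × 2 * length xs + 15 * n ≡ 3 * n ^ 2 + 20))
proposition3p4 n@(suc (suc (suc m))) (s≤s (s≤s (s≤s z≤n))) =
  (λ l₁ l₂ _ _ _ _ → Elℓ-isMatching n l₁ l₂) ,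
  InE⇒InElℓ-sums ,
  map sums (canonicalTriples n) ,
  sums-canonicalTriples⁺ m ,
  ∈-sums-canonicalTriples⇔InEn m ,
  trans (cong (λ l → 2 * l + 15 * n) (length-map sums (canonicalTriples n))) (length-canonicalTriples m)
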